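{- Let $T$ be a Steiner-closed search tree on a tree $S$, let $x\in V(S)$, and let $P$ be the set of nodes on the search path of $x$ in $T$. A node $p\in P$ is a branching node of $P$ if and only if $|\delta(T_p)|=2$ and $p$ has a child $q$ in $T$ with $q\in P$ and $|\delta(T_q)|=1$.
   Context: A search tree on an unrooted tree $S$ (STT) is a rooted tree $T$ with $V(T)=V(S)$ defined recursively: the root $r$ is any node of $S$, and the subtrees of $T$ rooted at the children of $r$ are search trees on the connected components of $S\setminus r$. The search path of $x$ is the path in $T$ from the root to $x$. $T_y$ is the subtree of $T$ rooted at $y$; $\delta(T_y)$ is the set of nodes outside $V(T_y)$ adjacent in $S$ to a node of $V(T_y)$. The convex hull $\mathrm{ch}(A)$ of $A\subseteq V(S)$ is the subtree of $S$ induced by the union of all paths between nodes of $A$; $A$ is Steiner-closed if every node of $\mathrm{ch}(A)\setminus A$ is adjacent to exactly two nodes of $\mathrm{ch}(A)$; $T$ is Steiner-closed if the node set of every search path is Steiner-closed. A branching node of $P$ is a node of degree more than $2$ in $\mathrm{ch}(P)$. -}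

module Defs where

open import Level using (0ℓ)
open import Data.Nat using (ℕ; suc; _<_; _≤_)
open import Data.Fin using (Fin)
open import Data.List using (List; []; _∷_; head; last; length)
open import Data.List.Relation.Unary.All using (All)
open import Data.List.Relation.Unary.Unique.Propositional using (Unique)
open import Data.List.Membership.Propositional using (_∈_)
open import Data.Maybe using (Maybe; just; nothing)
open import Data.Product using (Σ; _×_; ∃)
open import Data.Empty using (⊥)
open import Data.Unit using (⊤)
open import Relation.Nullary using (¬_)
open import Relation.Binary.PropositionalEquality using (_≡_; _≢_)
open import Function.Bundles using (_⇔_)

Pred : ℕ → Set₁
Pred n = Fin n → Set

Card : ∀ {n} → Pred n → ℕ → Set
Card {n} P k = Σ (List (Fin n)) λ xs →
  Unique xs × length xs ≡ k × (∀ z → P z ⇔ (z ∈ xs))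

module _ {n : ℕ} (E : Fin n → Fin n → Set) where

  Chain : List (Fin n) → Set
  Chain []           = ⊤
  Chain (x ∷ [])     = ⊤
  Chain (x ∷ y ∷ xs) = E x y × Chain (y ∷ xs)

  IsPath : Fin n → Fin n → List (Fin n) → Set
  IsPath u v xs = Chain xs × Unique xs × head xs ≡ just u × last xs ≡ just v

  IsCycle : List (Fin n) → Set
  IsCycle [] = ⊥
  IsCycle (x ∷ xs) = 2 ≤ length xs × Chain (x ∷ xs) × Unique (x ∷ xs)
                     × Σ (Fin n) (λ y → last (x ∷ xs) ≡ just y × E y x)

  record IsTree : Set where
    field
      sym       : ∀ {u v} → E u v → E v u
      irrefl    : ∀ {v} → ¬ E v v
      connected : ∀ u v → Σ (List (Fin n)) (IsPath u v)
      acyclic   : ∀ xs → ¬ IsCycle xs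

  -- the vertex set of the connected component of v in S[U] ∖ r
  Comp : Pred n → Fin n → Fin n → Pred n
  Comp U r v w = Σ (List (Fin n)) λ xs →
    IsPath v w xs × All (λ z → U z × z ≢ r) xs

  -- A rooted tree T on Fin n is given by its parent function
  -- (nothing for the root).
  -- STTOn par U a : the restriction of T to U is a search tree on the
  -- (connected) subgraph S[U], whose root has parent a.
  data STTOn (par : Fin n → Maybe (Fin n)) : Pred n → Maybe (Fin n) → Set₁ where
    node : ∀ {U a} (r : Fin n) → U r → par r ≡ a →
           (∀ v → U v → v ≢ r → STTOn par (Comp U r v) (just r)) →
           STTOn par U a

  IsSTT : (Fin n → Maybe (Fin n)) → Set₁
  IsSTT par = STTOn par (λ _ → ⊤) nothing

  -- convex hull ch(A): vertices lying on a path between two nodes of A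
  -- (ch(A) is the subgraph of S induced by this vertex set)
  Hull : Pred n → Pred n
  Hull A z = Σ (Fin n) λ a → Σ (Fin n) λ b → Σ (List (Fin n)) λ xs →
    A a × A b × IsPath a b xs × z ∈ xs

  HullNbrs : Pred n → Fin n → Pred n
  HullNbrs A z w = Hull A w × E z w

  SteinerClosed : Pred n → Set
  SteinerClosed A = ∀ z → Hull A z → ¬ A z → Card (HullNbrs A z) 2

  Branching : Pred n → Fin n → Set
  Branching P p = Hull P p × Σ ℕ λ k → 2 < k × Card (HullNbrs P p) k

-- ancestry in the rooted tree given by par: Anc par y z  iff  y lies on
-- the path from the root to z (including y ≡ z)
data Anc {n : ℕ} (par : Fin n → Maybe (Fin n)) (y : Fin n) : Fin n → Set where
  here : Anc par y y
  up   : ∀ {z w} → par z ≡ just w → Anc par y w → Anc par y z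

Sub : ∀ {n} → (Fin n → Maybe (Fin n)) → Fin n → Pred n
Sub par y z = Anc par y z

SearchPath : ∀ {n} → (Fin n → Maybe (Fin n)) → Fin n → Pred n
SearchPath par x y = Anc par y x

Boundary : ∀ {n} → (Fin n → Fin n → Set) → (Fin n → Maybe (Fin n)) → Fin n → Pred n
Boundary {n} E par y z = ¬ Sub par y z × Σ (Fin n) λ w → Sub par y w × E z w

SteinerClosedSTT : ∀ {n} → (Fin n → Fin n → Set) → (Fin n → Maybe (Fin n)) → Set
SteinerClosedSTT E par = ∀ x → SteinerClosed E (SearchPath par x)

-- Every neighbour of p in ch(P) starts a branch which, avoiding p,
-- reaches P either above p (an ancestor of p's parent w₀) or below p. Two branches cannot go down: P is a
-- chain, so both would end in the subtree of the same child q of p, which is connected and avoids p. Three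
-- branches cannot go up: p lies in the hull of the search path of w₀ but not on it, so Steiner-closedness
-- gives it just two neighbours there. Hence p branches iff one branch goes down and two go up. The upward
-- branches lead out of T_p to the two nodes of δ(T_p), and the downward one, through T_q, makes p the only
-- node of δ(T_q). Conversely, the routes from p through T_p ∖ T_q to the two nodes of δ(T_p) leave p along
-- different edges, since a fork between them would be a node of ch(P) ∖ P with three neighbours in ch(P).
module Submission where

open import Defs
open import Data.Nat using (ℕ; _<_; z≤n; s≤s)
open import Data.Fin using (Fin; _≟_)
open import Data.Fin.Properties using (any?)
open import Data.Maybe using (Maybe; just; nothing)
open import Data.Maybe.Properties using (just-injective)
open import Data.Product using (Σ; _×_; _,_; proj₁; proj₂)
open import Data.Sum using (_⊎_; inj₁; inj₂)
open import Data.Empty using (⊥; ⊥-elim)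
open import Data.Unit using (⊤; tt)
open import Data.List using (List; []; _∷_; last; length; filter; allFin)
open import Data.List.Relation.Unary.All as All using (All; []; _∷_; lookup)
open import Data.List.Relation.Unary.All.Properties using (¬Any⇒All¬; All¬⇒¬Any)
open import Data.List.Relation.Unary.Any using (here; there)
open import Data.List.Relation.Unary.Unique.Propositional using (Unique; []; _∷_)
open import Data.List.Relation.Unary.Unique.Propositional.Properties using (filter⁺; allFin⁺)
open import Data.List.Membership.Propositional using (_∈_; _∉_)
open import Data.List.Membership.Propositional.Properties using (∈-filter⁺; ∈-filter⁻; ∈-allFin)
import Data.List.Membership.DecPropositional as DecMembership
open import Relation.Nullary using (¬_; Dec; yes; no)
open import Relation.Nullary.Decidable using (_×-dec_)
open import Relation.Binary.PropositionalEquality using (_≡_; _≢_; refl; sym; trans; cong; subst; ≢-sym)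
open import Function.Base using (_∘_)
open import Function.Bundles using (_⇔_; mk⇔; Equivalence)

module Walks {n : ℕ} (E : Fin n → Fin n → Set) (tree : IsTree E) where
  open IsTree tree renaming (sym to E-sym)
  open DecMembership (_≟_ {n = n}) using (_∈?_)

  data Walk (X : Pred n) : Fin n → Fin n → Set where
    stop : ∀ {u} → X u → Walk X u u
    step : ∀ {u v w} → E u v → X u → Walk X v w → Walk X u w

  walk-first : ∀ {X u v} → Walk X u v → X u
  walk-first (stop xu)     = xu
  walk-first (step _ xu _) = xu

  walk-last : ∀ {X u v} → Walk X u v → X v
  walk-last (stop xv)    = xv
  walk-last (step _ _ r) = walk-last r

  _++ʷ_ : ∀ {X u v w} → Walk X u v → Walk X v w → Walk X u w
  stop _      ++ʷ r′ = r′
  step e xu r ++ʷ r′ = step e xu (r ++ʷ r′)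

  walk-snoc : ∀ {X u v w} → Walk X u v → E v w → X w → Walk X u w
  walk-snoc r e xw = r ++ʷ step e (walk-last r) (stop xw)

  walk-reverse : ∀ {X u v} → Walk X u v → Walk X v u
  walk-reverse (stop xu)     = stop xu
  walk-reverse (step e xu r) = walk-snoc (walk-reverse r) (E-sym e) xu

  walk-map : ∀ {X Y : Pred n} → (∀ {z} → X z → Y z) → ∀ {u v} → Walk X u v → Walk Y u v
  walk-map f (stop xu)     = stop (f xu)
  walk-map f (step e xu r) = step e (f xu) (walk-map f r)

  walk-prefixes : ∀ {X u v} → Walk X u v → Walk (Walk X u) u v
  walk-prefixes (stop xu)     = stop (stop xu)
  walk-prefixes (step e xu r) = step e (stop xu) (walk-map (step e xu) (walk-prefixes r))

  Path : Pred n → Fin n → Fin n → Set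
  Path X u v = Σ (List (Fin n)) λ rest →
    Chain E (u ∷ rest) × Unique (u ∷ rest) × last (u ∷ rest) ≡ just v × All X (u ∷ rest)

  path-from : ∀ {X u a l v} → u ∈ (a ∷ l) → Chain E (a ∷ l) → Unique (a ∷ l) →
              last (a ∷ l) ≡ just v → All X (a ∷ l) → Path X u v
  path-from {l = l}     (here refl) c un la al = l , c , un , la , al
  path-from {l = _ ∷ _} (there m) (_ , c) (_ ∷ un) la (_ ∷ al) = path-from m c un la al

  -- When u recurs later on the path, the loop back to it is cut out.
  walk→path : ∀ {X u v} → Walk X u v → Path X u v
  walk→path (stop xu) = [] , tt , [] ∷ [] , refl , xu ∷ []
  walk→path {u = u} (step {v = v} e xu r) with walk→path r
  ... | rest , c , un , la , al with u ∈? (v ∷ rest)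
  ...   | yes u∈ = path-from u∈ c un la al
  ...   | no u∉  = v ∷ rest , (e , c) , ¬Any⇒All¬ _ u∉ ∷ un , la , xu ∷ al

  chain→walk : ∀ {X} x xs {v} → Chain E (x ∷ xs) → All X (x ∷ xs) → last (x ∷ xs) ≡ just v → Walk X x v
  chain→walk x []       _        (px ∷ _)  refl = stop px
  chain→walk x (y ∷ xs) (ex , c) (px ∷ al) la   = step ex px (chain→walk y xs c al la)

  path→walk : ∀ {X u v} → Path X u v → Walk X u v
  path→walk (rest , c , _ , la , al) = chain→walk _ rest c al la

  last-∈ : ∀ (x : Fin n) xs {v} → last (x ∷ xs) ≡ just v → v ∈ (x ∷ xs)
  last-∈ x []       refl = here refl
  last-∈ x (y ∷ xs) la   = there (last-∈ y xs la)

  connected-walk : ∀ u v → Walk (λ _ → ⊤) u v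
  connected-walk u v with connected u v
  ... | x ∷ rest , c , _ , refl , la = chain→walk x rest c (All.universal (λ _ → tt) _) la

  -- Two distinct neighbours of u joined avoiding u would close a cycle through u.
  no-detour : ∀ {u y z} → E u y → E u z → y ≢ z → ¬ Walk (_≢ u) y z
  no-detour {u} {y} {z} euy euz y≢z r with walk→path r
  ... | [] , _ , _ , refl , _ = y≢z refl
  ... | v ∷ rest , c , un , la , al =
    acyclic (u ∷ y ∷ v ∷ rest)
      (s≤s (s≤s z≤n) , (euy , c) , All.map ≢-sym al ∷ un , z , la , E-sym euz)

  branch-unique : ∀ {p w w′ z} → E p w → E p w′ → Walk (_≢ p) w z → Walk (_≢ p) w′ z → w ≡ w′
  branch-unique {w = w} {w′} e e′ r r′ with w ≟ w′
  ... | yes w≡w′ = w≡w′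
  ... | no w≢w′  = ⊥-elim (no-detour e e′ w≢w′ (r ++ʷ walk-reverse r′))

  path-unique′ : ∀ u xs ys {v} → Chain E (u ∷ xs) → Chain E (u ∷ ys) → Unique (u ∷ xs) → Unique (u ∷ ys) →
                 last (u ∷ xs) ≡ just v → last (u ∷ ys) ≡ just v → xs ≡ ys
  path-unique′ u [] [] _ _ _ _ _ _ = refl
  path-unique′ u [] (y ∷ ys) _ _ _ (u∉ ∷ _) refl ly = ⊥-elim (All¬⇒¬Any u∉ (last-∈ y ys ly))
  path-unique′ u (x ∷ xs) [] _ _ (u∉ ∷ _) _ lx refl = ⊥-elim (All¬⇒¬Any u∉ (last-∈ x xs lx))
  path-unique′ u (x ∷ xs) (y ∷ ys) (ex , cx) (ey , cy) (u∉x ∷ ux) (u∉y ∷ uy) lx ly with x ≟ y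
  ... | yes refl = cong (x ∷_) (path-unique′ x xs ys cx cy ux uy lx ly)
  ... | no x≢y   = ⊥-elim (no-detour ex ey x≢y
                     (chain→walk x xs cx (All.map ≢-sym u∉x) lx
                       ++ʷ walk-reverse (chain→walk y ys cy (All.map ≢-sym u∉y) ly)))

  path-unique : ∀ {X Y u v} (p : Path X u v) (q : Path Y u v) → proj₁ p ≡ proj₁ q
  path-unique (xs , cx , ux , lx , _) (ys , cy , uy , ly , _) = path-unique′ _ xs ys cx cy ux uy lx ly

  edge-path : ∀ {u v} → E u v → Path (λ _ → ⊤) u v
  edge-path {u} e =
    _ ∷ [] , (e , tt) , ((λ u≡v → irrefl (subst (E u) (sym u≡v) e)) ∷ []) ∷ [] ∷ [] , refl , tt ∷ tt ∷ []

  -- Adjacency is decided by the length of the unique path.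
  E? : ∀ u v → Dec (E u v)
  E? u v with walk→path (connected-walk u v)
  ... | []     , _       , _ , refl , _ = no irrefl
  ... | _ ∷ [] , (e , _) , _ , refl , _ = yes e
  ... | p@(_ ∷ _ ∷ _ , _) = no λ e → case-⊥ (path-unique p (edge-path e))
    where
      case-⊥ : ∀ {a b c : Fin n} {cs} → _≡_ {A = List (Fin n)} (a ∷ b ∷ cs) (c ∷ []) → ⊥
      case-⊥ ()

  -- A walk avoiding p exists iff p is off the unique path.
  avoiding? : ∀ p w z → Dec (Walk (_≢ p) w z)
  avoiding? p w z with walk→path (connected-walk w z)
  ... | π@(rest , c , un , la , _) with p ∈? (w ∷ rest)
  ...   | no p∉  = yes (path→walk (rest , c , un , la , All.map ≢-sym (¬Any⇒All¬ _ p∉)))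
  ...   | yes p∈ = no λ r → All¬⇒¬Any (All.map ≢-sym (avoids r)) p∈
    where
      avoids : Walk (_≢ p) w z → All (_≢ p) (w ∷ rest)
      avoids r with walk→path r | path-unique (walk→path r) π
      ... | _ , _ , _ , _ , al | refl = al

  walk-exit : ∀ {X Q : Pred n} → (∀ z → Dec (Q z)) → ∀ {u v} → Walk X u v → Q u → ¬ Q v →
              Σ (Fin n) λ s → Σ (Fin n) λ s′ → Walk (λ z → X z × Q z) u s × E s s′ × ¬ Q s′ × X s′
  walk-exit Q? (stop _) qu ¬qv = ⊥-elim (¬qv qu)
  walk-exit Q? (step {v = v} e xu r) qu ¬qv with Q? v
  ... | no ¬qv′ = _ , v , stop (xu , qu) , e , ¬qv′ , walk-first r
  ... | yes qv′ with walk-exit Q? r qv′ ¬qv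
  ...   | s , s′ , pre , ss′ , ¬qs′ , xs′ = s , s′ , step e (xu , qu) pre , ss′ , ¬qs′ , xs′

  walk-avoids : ∀ {X Q : Pred n} {u v} → Walk X u v → ¬ Q v →
                (∀ {s s′} → E s s′ → Q s → ¬ Q s′ → X s′ → ⊥) → Walk (λ z → X z × ¬ Q z) u v
  walk-avoids (stop xu) ¬qu _ = stop (xu , ¬qu)
  walk-avoids (step e xu r) ¬qv no-exit with walk-avoids r ¬qv no-exit
  ... | r′ = step e (xu , λ qu → no-exit e qu (proj₂ (walk-first r′)) (proj₁ (walk-first r′))) r′

  hull-path : ∀ {A : Pred n} {a b xs y} → IsPath E a b xs → A a → A b → y ∈ xs → Hull E A y
  hull-path {a = a} {b} {xs} π Aa Ab y∈ = a , b , xs , Aa , Ab , π , y∈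

  hull-self : ∀ {A : Pred n} {a} → A a → Hull E A a
  hull-self Aa = hull-path {xs = _ ∷ []} (tt , [] ∷ [] , refl , refl) Aa Aa (here refl)

  extend-path : ∀ {p w z} → E p w → (π : Path (_≢ p) w z) → IsPath E p z (p ∷ w ∷ proj₁ π)
  extend-path e (rest , c , un , la , al) = (e , c) , (All.map ≢-sym al ∷ un) , refl , la

  hullNbr-from : ∀ {A : Pred n} {p w z} → A p → E p w → Walk (_≢ p) w z → A z → Hull E A w
  hullNbr-from Ap e r Az = hull-path (extend-path e (walk→path r)) Ap Az (there (here refl))

  on-path-avoiding : ∀ p a xs {b w} → Chain E (a ∷ xs) → Unique (a ∷ xs) → last (a ∷ xs) ≡ just b →
                     w ∈ (a ∷ xs) → w ≢ p → Walk (_≢ p) w a ⊎ Walk (_≢ p) w b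
  on-path-avoiding p a xs c un la (here refl) w≢p = inj₁ (stop w≢p)
  on-path-avoiding p a (x ∷ xs) (e , c) (a∉ ∷ un) la (there w∈) w≢p
    with on-path-avoiding p x xs c un la w∈ w≢p
  ... | inj₂ r = inj₂ r
  ... | inj₁ r with a ≟ p
  ...   | no a≢p  = inj₁ (walk-snoc r (E-sym e) a≢p)
  ...   | yes refl = inj₂ (r ++ʷ chain→walk x xs c (All.map ≢-sym a∉) la)

  predecessor-on-path : ∀ {p} a xs → Chain E (a ∷ xs) → p ∈ (a ∷ xs) → a ≢ p →
                        Σ (Fin n) λ v → v ∈ (a ∷ xs) × E v p × Walk (_≢ p) v a
  predecessor-on-path a xs c (here a≡p) a≢p = ⊥-elim (a≢p (sym a≡p))
  predecessor-on-path {p} a (y ∷ xs) (e , c) (there p∈) a≢p with y ≟ p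
  ... | yes refl = a , here refl , e , stop a≢p
  ... | no y≢p with predecessor-on-path y xs c p∈ y≢p
  ...   | v , v∈ , vp , r = v , there v∈ , vp , walk-snoc r (E-sym e) a≢p

  -- If p were off the path, wᵢ and wⱼ would be joined avoiding p.
  through-branches : ∀ {p wᵢ wⱼ zᵢ zⱼ} → E p wᵢ → E p wⱼ → wᵢ ≢ wⱼ →
                     Walk (_≢ p) wᵢ zᵢ → Walk (_≢ p) wⱼ zⱼ →
                     Σ (List (Fin n)) λ xs → IsPath E zᵢ zⱼ xs × p ∈ xs × wᵢ ∈ xs
  through-branches {p} {zᵢ = zᵢ} {zⱼ} eᵢ eⱼ wᵢ≢wⱼ rᵢ rⱼ with walk→path (connected-walk zᵢ zⱼ)
  ... | rest , c , un , la , _ with p ∈? (zᵢ ∷ rest)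
  ...   | no p∉ = ⊥-elim (wᵢ≢wⱼ (branch-unique eᵢ eⱼ
                     (rᵢ ++ʷ path→walk (rest , c , un , la , All.map ≢-sym (¬Any⇒All¬ _ p∉))) rⱼ))
  ...   | yes p∈ with predecessor-on-path zᵢ rest c p∈ (walk-last rᵢ)
  ...     | v , v∈ , vp , rᵥ with branch-unique (E-sym vp) eᵢ rᵥ rᵢ
  ...       | refl = zᵢ ∷ rest , (c , un , refl , la) , p∈ , v∈

  hullNbr⇒walk : ∀ {A : Pred n} {p w} → HullNbrs E A p w → Σ (Fin n) λ z → A z × Walk (_≢ p) w z
  hullNbr⇒walk ((a , b , (_ ∷ rest) , Aa , Ab , (c , un , refl , la) , w∈) , epw)
    with on-path-avoiding _ a rest c un la w∈ (λ { refl → irrefl epw })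
  ... | inj₁ r = a , Aa , r
  ... | inj₂ r = _ , Ab , r

  record Fork (u m₀ : Fin n) (R₁ R₂ : List (Fin n)) : Set where
    field
      m pre s₁ s₂ : Fin n
      m∈₁    : m ∈ (m₀ ∷ R₁)
      m∈₂    : m ∈ (m₀ ∷ R₂)
      pre∈   : pre ∈ (u ∷ m₀ ∷ R₁)
      s₁∈    : s₁ ∈ (m₀ ∷ R₁)
      s₂∈    : s₂ ∈ (m₀ ∷ R₂)
      m-pre  : E m pre
      m-s₁   : E m s₁
      m-s₂   : E m s₂
      pre≢s₁ : pre ≢ s₁
      pre≢s₂ : pre ≢ s₂
      s₁≢s₂  : s₁ ≢ s₂

  fork-shift : ∀ {u m₀ x R₁ R₂} → Fork m₀ x R₁ R₂ → Fork u m₀ (x ∷ R₁) (x ∷ R₂)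
  fork-shift φ = record
    { m = m ; pre = pre ; s₁ = s₁ ; s₂ = s₂
    ; m∈₁ = there m∈₁ ; m∈₂ = there m∈₂ ; pre∈ = there pre∈ ; s₁∈ = there s₁∈ ; s₂∈ = there s₂∈
    ; m-pre = m-pre ; m-s₁ = m-s₁ ; m-s₂ = m-s₂
    ; pre≢s₁ = pre≢s₁ ; pre≢s₂ = pre≢s₂ ; s₁≢s₂ = s₁≢s₂ }
    where open Fork φ

  fork : ∀ u m₀ R₁ R₂ {e₁ e₂} → E u m₀ → u ∉ (m₀ ∷ R₁) → u ∉ (m₀ ∷ R₂) →
         Chain E (m₀ ∷ R₁) → Chain E (m₀ ∷ R₂) → Unique (m₀ ∷ R₁) → Unique (m₀ ∷ R₂) →
         last (m₀ ∷ R₁) ≡ just e₁ → last (m₀ ∷ R₂) ≡ just e₂ → e₁ ∉ (m₀ ∷ R₂) → e₂ ∉ (m₀ ∷ R₁) →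
         Fork u m₀ R₁ R₂
  fork u m₀ [] R₂ _ _ _ _ _ _ _ refl _ e₁∉ _ = ⊥-elim (e₁∉ (here refl))
  fork u m₀ (_ ∷ _) [] _ _ _ _ _ _ _ _ refl _ e₂∉ = ⊥-elim (e₂∉ (here refl))
  fork u m₀ (x₁ ∷ R₁) (x₂ ∷ R₂) e u∉₁ u∉₂ (e₁ , c₁) (e₂ , c₂) (m₀∉₁ ∷ un₁) (m₀∉₂ ∷ un₂) l₁ l₂ e₁∉ e₂∉
    with x₁ ≟ x₂
  ... | no x₁≢x₂ = record
    { m = m₀ ; pre = u ; s₁ = x₁ ; s₂ = x₂
    ; m∈₁ = here refl ; m∈₂ = here refl ; pre∈ = here refl
    ; s₁∈ = there (here refl) ; s₂∈ = there (here refl)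
    ; m-pre = E-sym e ; m-s₁ = e₁ ; m-s₂ = e₂
    ; pre≢s₁ = λ u≡x₁ → u∉₁ (there (here u≡x₁)) ; pre≢s₂ = λ u≡x₂ → u∉₂ (there (here u≡x₂))
    ; s₁≢s₂ = x₁≢x₂ }
  ... | yes refl = fork-shift (fork m₀ x₁ R₁ R₂ e₁ (All¬⇒¬Any m₀∉₁) (All¬⇒¬Any m₀∉₂) c₁ c₂ un₁ un₂ l₁ l₂
                                (e₁∉ ∘ there) (e₂∉ ∘ there))

module SearchTrees {n : ℕ} (E : Fin n → Fin n → Set) (tree : IsTree E)
                   (par : Fin n → Maybe (Fin n)) (stt : IsSTT E par) where
  open Walks E tree
  open IsTree tree renaming (sym to E-sym)

  infix 4 _⊑_ _⊑?_

  _⊑_ : Fin n → Fin n → Set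
  _⊑_ = Anc par

  parent-unique : ∀ {z w w′} → par z ≡ just w → par z ≡ just w′ → w ≡ w′
  parent-unique e e′ = just-injective (trans (sym e) e′)

  ⊑-trans : ∀ {a b c} → a ⊑ b → b ⊑ c → a ⊑ c
  ⊑-trans a⊑b here        = a⊑b
  ⊑-trans a⊑b (up e b⊑w) = up e (⊑-trans a⊑b b⊑w)

  ⊑-linear : ∀ {a b z} → a ⊑ z → b ⊑ z → a ⊑ b ⊎ b ⊑ a
  ⊑-linear here       b⊑z         = inj₂ b⊑z
  ⊑-linear (up e a⊑w) here        = inj₁ (up e a⊑w)
  ⊑-linear (up e a⊑w) (up e′ b⊑w′) with parent-unique e e′
  ... | refl = ⊑-linear a⊑w b⊑w′

  ⊑-parent : ∀ {d q p} → d ⊑ q → d ≢ q → par q ≡ just p → d ⊑ p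
  ⊑-parent here       d≢q _  = ⊥-elim (d≢q refl)
  ⊑-parent (up e d⊑w) _   qp with parent-unique e qp
  ... | refl = d⊑w

  child-towards : ∀ {p z} → p ⊑ z → z ≢ p → Σ (Fin n) λ q → par q ≡ just p × q ⊑ z
  child-towards here z≢p = ⊥-elim (z≢p refl)
  child-towards {p} (up {w = w} e p⊑w) _ with w ≟ p
  ... | yes refl = _ , e , here
  ... | no w≢p with child-towards p⊑w w≢p
  ...   | q , qp , q⊑w = q , qp , up e q⊑w

  AboveOpt : Maybe (Fin n) → Fin n → Set
  AboveOpt nothing  _ = ⊥
  AboveOpt (just w) y = y ⊑ w

  up-opt : ∀ {r a y} → par r ≡ a → AboveOpt a y → y ⊑ r
  up-opt {a = just _} e y⊑w = up e y⊑w

  down-opt : ∀ {r a y w} → par r ≡ a → par r ≡ just w → y ⊑ w → AboveOpt a y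
  down-opt ra rw y⊑w = subst (λ a → AboveOpt a _) (trans (sym rw) ra) y⊑w

  root : ∀ {U a} → STTOn E par U a → Fin n
  root (node r _ _ _) = r

  root-in : ∀ {U a} (D : STTOn E par U a) → U (root D)
  root-in (node _ Ur _ _) = Ur

  root-par : ∀ {U a} (D : STTOn E par U a) → par (root D) ≡ a
  root-par (node _ _ ra _) = ra

  comp⇒walk : ∀ {U r v w} → Comp E U r v w → Walk (λ z → U z × z ≢ r) v w
  comp⇒walk (_ ∷ rest , (c , un , refl , la) , al) = path→walk (rest , c , un , la , al)

  walk⇒comp : ∀ {U r v w} → Walk (λ z → U z × z ≢ r) v w → Comp E U r v w
  walk⇒comp r with walk→path r
  ... | rest , c , un , la , al = _ ∷ rest , (c , un , refl , la) , al

  comp-self : ∀ {U : Pred n} {r z} → U z → z ≢ r → Comp E U r z z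
  comp-self Uz z≢r = walk⇒comp (stop (Uz , z≢r))

  root-⊑ : ∀ {U a} (D : STTOn E par U a) → ∀ {z} → U z → root D ⊑ z
  root-⊑ (node r _ _ ch) {z} Uz with z ≟ r
  ... | yes refl = here
  ... | no z≢r = ⊑-trans (up (root-par (ch z Uz z≢r)) here) (root-⊑ (ch z Uz z≢r) (comp-self Uz z≢r))

  ¬⊑-parent-on : ∀ {U a} (D : STTOn E par U a) → (∀ {y} → AboveOpt a y → ¬ U y) →
                 ∀ {z w} → U z → par z ≡ just w → ¬ z ⊑ w
  ¬⊑-parent-on (node r Ur ra ch) outside {z} Uz zw z⊑w with z ≟ r
  ... | yes refl = outside (down-opt ra zw z⊑w) Ur
  ... | no z≢r = ¬⊑-parent-on (ch z Uz z≢r) outside′ (comp-self Uz z≢r) zw z⊑w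
    where
      outside′ : ∀ {y} → y ⊑ r → ¬ Comp E _ r z y
      outside′ here         Cy = proj₂ (walk-last (comp⇒walk Cy)) refl
      outside′ (up e y⊑w′) Cy = outside (down-opt ra e y⊑w′) (proj₁ (walk-last (comp⇒walk Cy)))

  ¬⊑-parent : ∀ {z w} → par z ≡ just w → ¬ z ⊑ w
  ¬⊑-parent = ¬⊑-parent-on stt (λ ()) tt

  ⊑-antisym : ∀ {a b} → a ⊑ b → b ⊑ a → a ≡ b
  ⊑-antisym here       _   = refl
  ⊑-antisym (up e a⊑w) b⊑a = ⊥-elim (¬⊑-parent e (⊑-trans b⊑a a⊑w))

  subtree-avoids-parent : ∀ {q p z} → par q ≡ just p → q ⊑ z → z ≢ p
  subtree-avoids-parent qp q⊑z refl = ¬⊑-parent qp q⊑z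

  child-⊑⇒≡ : ∀ {p q q′} → par q ≡ just p → par q′ ≡ just p → q ⊑ q′ → q ≡ q′
  child-⊑⇒≡ qp q′p here = refl
  child-⊑⇒≡ qp q′p (up e q⊑w) with parent-unique e q′p
  ... | refl = ⊥-elim (¬⊑-parent qp q⊑w)

  child-unique : ∀ {p q q′ y} → par q ≡ just p → par q′ ≡ just p → q ⊑ y → q′ ⊑ y → q ≡ q′
  child-unique qp q′p q⊑y q′⊑y with ⊑-linear q⊑y q′⊑y
  ... | inj₁ q⊑q′ = child-⊑⇒≡ qp q′p q⊑q′
  ... | inj₂ q′⊑q = sym (child-⊑⇒≡ q′p qp q′⊑q)

  record Subproblem (y : Fin n) : Set₁ where
    field
      {U}     : Pred n
      {a}     : Maybe (Fin n)
      D       : STTOn E par U a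
      root≡   : root D ≡ y
      covers  : ∀ {z} → y ⊑ z → U z
      spanned : ∀ {z} → U z → Walk U y z

  subproblem-on : ∀ {U a} (D : STTOn E par U a) → (∀ {z} → root D ⊑ z → U z) →
                  (∀ {z} → U z → Walk U (root D) z) → ∀ {y} → U y → Subproblem y
  subproblem-on {U} D@(node r _ _ ch) covers spanned {y} Uy with y ≟ r
  ... | yes refl = record { D = D ; root≡ = refl ; covers = covers ; spanned = spanned }
  ... | no y≢r = subproblem-on (ch y Uy y≢r) covers′ spanned′ (comp-self Uy y≢r)
    where
      Dy = ch y Uy y≢r
      -- z lies in the component of its own child-of-r ancestor, and that child is root Dy.
      covers′ : ∀ {z} → root Dy ⊑ z → Comp E U r y z
      covers′ {z} c⊑z = walk⇒comp (comp⇒walk (root-in Dy)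
                          ++ʷ walk-reverse (subst (Walk _ z) (sym c≡c′) (comp⇒walk (root-in Dz))))
        where
          z≢r : z ≢ r
          z≢r refl = ¬⊑-parent (root-par Dy) c⊑z
          Uz = covers (⊑-trans (up (root-par Dy) here) c⊑z)
          Dz = ch z Uz z≢r
          c≡c′ : root Dy ≡ root Dz
          c≡c′ = child-unique (root-par Dy) (root-par Dz) c⊑z (root-⊑ Dz (comp-self Uz z≢r))
      into-comp : ∀ {t} → Walk (λ z → U z × z ≢ r) y t → Walk (Comp E U r y) y t
      into-comp w = walk-map walk⇒comp (walk-prefixes w)
      spanned′ : ∀ {z} → Comp E U r y z → Walk (Comp E U r y) (root Dy) z
      spanned′ Cz = walk-reverse (into-comp (comp⇒walk (root-in Dy))) ++ʷ into-comp (comp⇒walk Cz)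

  subtree-connected : ∀ {y z} → y ⊑ z → Walk (y ⊑_) y z
  subtree-connected y⊑z = walk-map (λ Ut → subst (_⊑ _) root≡ (root-⊑ D Ut)) (spanned (covers y⊑z))
    where open Subproblem (subproblem-on stt (λ _ → tt) (λ _ → connected-walk (root stt) _) tt)

  walk-in-subtree : ∀ {q a b} → q ⊑ a → q ⊑ b → Walk (q ⊑_) a b
  walk-in-subtree q⊑a q⊑b = walk-reverse (subtree-connected q⊑a) ++ʷ subtree-connected q⊑b

  ⊑-root? : ∀ {U a} (D : STTOn E par U a) → (∀ y → Dec (AboveOpt a y)) → ∀ y → Dec (y ⊑ root D)
  ⊑-root? (node r _ ra _) above? y with y ≟ r
  ... | yes refl = yes here
  ... | no y≢r with above? y
  ...   | yes y⊑a = yes (up-opt ra y⊑a)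
  ...   | no ¬y⊑a = no λ { here → y≢r refl ; (up e y⊑w) → ¬y⊑a (down-opt ra e y⊑w) }

  ⊑?-on : ∀ {U a} (D : STTOn E par U a) → (∀ y → Dec (AboveOpt a y)) → ∀ {z} → U z → ∀ y → Dec (y ⊑ z)
  ⊑?-on D@(node r _ _ ch) above? {z} Uz y with z ≟ r
  ... | yes refl = ⊑-root? D above? y
  ... | no z≢r = ⊑?-on (ch z Uz z≢r) (⊑-root? D above?) (comp-self Uz z≢r) y

  _⊑?_ : ∀ y z → Dec (y ⊑ z)
  y ⊑? z = ⊑?-on stt (λ _ → no λ ()) tt y

  edge-comparable-on : ∀ {U a} (D : STTOn E par U a) → ∀ {u v} → U u → U v → E u v → u ⊑ v ⊎ v ⊑ u
  edge-comparable-on D@(node r _ _ ch) {u} {v} Uu Uv e with u ≟ r | v ≟ r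
  ... | yes refl | _        = inj₁ (root-⊑ D Uv)
  ... | no _     | yes refl = inj₂ (root-⊑ D Uu)
  ... | no u≢r   | no v≢r   = edge-comparable-on (ch u Uu u≢r) (comp-self Uu u≢r)
                                (walk⇒comp (step e (Uu , u≢r) (stop (Uv , v≢r)))) e

  edge-comparable : ∀ {u v} → E u v → u ⊑ v ⊎ v ⊑ u
  edge-comparable = edge-comparable-on stt tt tt

  δ : Fin n → Pred n
  δ = Boundary E par

  δ⇒strictly-above : ∀ {y d} → δ y d → d ⊑ y × d ≢ y
  δ⇒strictly-above (¬y⊑d , w , y⊑w , dw) with edge-comparable dw
  ... | inj₂ w⊑d = ⊥-elim (¬y⊑d (⊑-trans y⊑w w⊑d))
  ... | inj₁ d⊑w with ⊑-linear d⊑w y⊑w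
  ...   | inj₁ d⊑y = d⊑y , λ { refl → ¬y⊑d here }
  ...   | inj₂ y⊑d = ⊥-elim (¬y⊑d y⊑d)

  δ⇒⊑-parent : ∀ {y w d} → par y ≡ just w → δ y d → d ⊑ w
  δ⇒⊑-parent yw δd = ⊑-parent (proj₁ (δ⇒strictly-above δd)) (proj₂ (δ⇒strictly-above δd)) yw

  -- Leave the subtree of q along the connecting walk from q up to p; the exit can only be p.
  parent∈δ : ∀ {q p} → par q ≡ just p → δ q p
  parent∈δ {q} qp with walk-exit (q ⊑?_) (walk-reverse (subtree-connected (up qp here))) here (¬⊑-parent qp)
  ... | s , s′ , pre , ss′ , ¬q⊑s′ , p⊑s′ = subst (δ q) (sym (⊑-antisym p⊑s′ (δ⇒⊑-parent qp δs′))) δs′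
    where
      δs′ : δ q s′
      δs′ = ¬q⊑s′ , s , proj₂ (walk-last pre) , E-sym ss′

  Below : Fin n → Pred n
  Below p z = p ⊑ z × z ≢ p

  Corridor : Fin n → Fin n → Fin n → Pred n
  Corridor p q d z = (Below p z ⊎ z ≡ d) × ¬ q ⊑ z

  corridor⇒≢ : ∀ {p q d z} → ¬ p ⊑ d → Corridor p q d z → z ≢ p
  corridor⇒≢ _    (inj₁ (_ , z≢p) , _) = z≢p
  corridor⇒≢ ¬p⊑d (inj₂ refl , _) refl = ¬p⊑d here

  corridor⇒avoiding : ∀ {p q d u v} → ¬ p ⊑ d → Walk (Corridor p q d) u v → Walk (_≢ p) u v
  corridor⇒avoiding ¬p⊑d = walk-map (corridor⇒≢ ¬p⊑d)

  corridor-excludes : ∀ {p q d d′} → ¬ p ⊑ d → d ≢ d′ → ¬ Corridor p q d′ d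
  corridor-excludes ¬p⊑d _    (inj₁ (p⊑d , _) , _) = ¬p⊑d p⊑d
  corridor-excludes _    d≢d′ (inj₂ d≡d′ , _)     = d≢d′ d≡d′

  module _ {p q} (qp : par q ≡ just p) (only-p : ∀ {d} → δ q d → d ≡ p) where

    -- T_q can only be entered through p, which the walk avoids.
    corridor-walk : ∀ {d u} → ¬ p ⊑ d → Walk (λ z → Below p z ⊎ z ≡ d) u d → Walk (Corridor p q d) u d
    corridor-walk {d} ¬p⊑d r = walk-avoids r (λ q⊑d → ¬p⊑d (⊑-trans (up qp here) q⊑d)) no-entry
      where
        no-entry : ∀ {s s′} → E s s′ → q ⊑ s → ¬ q ⊑ s′ → Below p s′ ⊎ s′ ≡ d → ⊥
        no-entry ss′ q⊑s ¬q⊑s′ s′∈ with only-p (¬q⊑s′ , _ , q⊑s , E-sym ss′)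
        no-entry _ _ _ (inj₁ (_ , p≢p)) | refl = p≢p refl
        no-entry _ _ _ (inj₂ p≡d)       | refl = ¬p⊑d (subst (p ⊑_) p≡d here)

    corridor-to-δ : ∀ {d} → δ p d → Σ (Fin n) λ u → E p u × Walk (Corridor p q d) u d
    corridor-to-δ {d} (¬p⊑d , t , p⊑t , dt) with walk→path (subtree-connected p⊑t)
    ... | [] , _ , _ , refl , _ = d , E-sym dt , corridor-walk ¬p⊑d (stop (inj₂ refl))
    ... | u ∷ rest , (pu , c) , (p∉ ∷ _) , la , (_ ∷ al) =
      u , pu , corridor-walk ¬p⊑d
        (walk-snoc (walk-map inj₁ (chain→walk u rest c (All.zip (al , All.map ≢-sym p∉)) la))
                   (E-sym dt) (inj₂ refl))

    corridor-from-branch : ∀ {w z} → E p w → Walk (_≢ p) w z → ¬ p ⊑ z →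
                           Σ (Fin n) λ d → δ p d × Walk (Corridor p q d) w d
    corridor-from-branch {w} pw r ¬p⊑z with p ⊑? w
    ... | no ¬p⊑w = w , (¬p⊑w , p , here , E-sym pw) , corridor-walk ¬p⊑w (stop (inj₂ refl))
    ... | yes p⊑w with walk-exit (p ⊑?_) r p⊑w ¬p⊑z
    ...   | s , s′ , pre , ss′ , ¬p⊑s′ , _ =
      s′ , (¬p⊑s′ , s , proj₂ (walk-last pre) , E-sym ss′) ,
      corridor-walk ¬p⊑s′ (walk-snoc (walk-map (λ (s≢p , p⊑s) → inj₁ (p⊑s , s≢p)) pre) ss′ (inj₂ refl))

module Cardinality {n : ℕ} where
  open Equivalence

  card-2-elim : ∀ {Q : Pred n} → Card Q 2 → Σ (Fin n) λ a → Σ (Fin n) λ b →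
                a ≢ b × Q a × Q b × (∀ z → Q z → z ≡ a ⊎ z ≡ b)
  card-2-elim (a ∷ b ∷ [] , (a≢b ∷ []) ∷ _ , refl , Q⇔) =
    a , b , a≢b , from (Q⇔ a) (here refl) , from (Q⇔ b) (there (here refl)) , λ z → which ∘ to (Q⇔ z)
    where
      which : ∀ {z} → z ∈ (a ∷ b ∷ []) → z ≡ a ⊎ z ≡ b
      which (here z≡a)         = inj₁ z≡a
      which (there (here z≡b)) = inj₂ z≡b

  card-1-elim : ∀ {Q : Pred n} → Card Q 1 → ∀ {y z} → Q y → Q z → y ≡ z
  card-1-elim (_ ∷ [] , _ , refl , Q⇔) {y} {z} Qy Qz with to (Q⇔ y) Qy | to (Q⇔ z) Qz
  ... | here refl | here refl = refl

  card-2-intro : ∀ {Q : Pred n} {a b} → a ≢ b → Q a → Q b → (∀ z → Q z → z ≡ a ⊎ z ≡ b) → Card Q 2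
  card-2-intro {a = a} {b} a≢b Qa Qb only =
    a ∷ b ∷ [] , (a≢b ∷ []) ∷ [] ∷ [] , refl , λ z → mk⇔ (member ∘ only z) holds
    where
      member : ∀ {z} → z ≡ a ⊎ z ≡ b → z ∈ (a ∷ b ∷ [])
      member (inj₁ z≡a) = here z≡a
      member (inj₂ z≡b) = there (here z≡b)
      holds : ∀ {z} → z ∈ (a ∷ b ∷ []) → _
      holds (here refl)         = Qa
      holds (there (here refl)) = Qb

  card-1-intro : ∀ {Q : Pred n} {c} → Q c → (∀ z → Q z → z ≡ c) → Card Q 1
  card-1-intro {c = c} Qc only = c ∷ [] , [] ∷ [] , refl , λ z → mk⇔ (here ∘ only z) holds
    where
      holds : ∀ {z} → z ∈ (c ∷ []) → _
      holds (here refl) = Qc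

  Three : Pred n → Set
  Three Q = Σ (Fin n) λ a → Σ (Fin n) λ b → Σ (Fin n) λ c →
            Q a × Q b × Q c × a ≢ b × a ≢ c × b ≢ c

  card-2-¬three : ∀ {Q : Pred n} → Card Q 2 → ¬ Three Q
  card-2-¬three card (a , b , c , Qa , Qb , Qc , a≢b , a≢c , b≢c) with card-2-elim card
  ... | _ , _ , _ , _ , _ , only with only a Qa | only b Qb | only c Qc
  ... | inj₁ refl | inj₁ refl | _         = a≢b refl
  ... | inj₂ refl | inj₂ refl | _         = a≢b refl
  ... | inj₁ refl | _         | inj₁ refl = a≢c refl
  ... | inj₂ refl | _         | inj₂ refl = a≢c refl
  ... | _         | inj₁ refl | inj₁ refl = b≢c refl
  ... | _         | inj₂ refl | inj₂ refl = b≢c refl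

  card->2⇒three : ∀ {Q : Pred n} {k} → Card Q k → 2 < k → Three Q
  card->2⇒three (a ∷ b ∷ c ∷ _ , (a≢b ∷ a≢c ∷ _) ∷ (b≢c ∷ _) ∷ _ , refl , Q⇔) _ =
    a , b , c , from (Q⇔ a) (here refl) , from (Q⇔ b) (there (here refl)) ,
    from (Q⇔ c) (there (there (here refl))) , a≢b , a≢c , b≢c
  card->2⇒three ([]            , _ , refl , _) ()
  card->2⇒three (_ ∷ []        , _ , refl , _) (s≤s ())
  card->2⇒three (_ ∷ _ ∷ []    , _ , refl , _) (s≤s (s≤s ()))

  three⇒card->2 : ∀ {Q : Pred n} {k} → Card Q k → Three Q → 2 < k
  three⇒card->2 (_ ∷ _ ∷ _ ∷ _ , _ , refl , _) _ = s≤s (s≤s (s≤s z≤n))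
  three⇒card->2 ([] , _ , refl , Q⇔) (a , _ , _ , Qa , _) with to (Q⇔ a) Qa
  ... | ()
  three⇒card->2 (_ ∷ [] , _ , refl , Q⇔) (a , b , _ , Qa , Qb , _ , a≢b , _)
    with to (Q⇔ a) Qa | to (Q⇔ b) Qb
  ... | here refl | here refl = ⊥-elim (a≢b refl)
  three⇒card->2 card@(_ ∷ _ ∷ [] , _ , refl , _) three = ⊥-elim (card-2-¬three card three)

  card-exists : ∀ {Q : Pred n} → (∀ z → Dec (Q z)) → Σ ℕ (Card Q)
  card-exists Q? = length (filter Q? (allFin n)) , filter Q? (allFin n) , filter⁺ Q? (allFin⁺ n) , refl ,
    λ z → mk⇔ (∈-filter⁺ Q? (∈-allFin z)) (proj₂ ∘ ∈-filter⁻ Q? {xs = allFin n})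

module SearchPathBranching {n : ℕ} (E : Fin n → Fin n → Set) (tree : IsTree E)
                           (par : Fin n → Maybe (Fin n)) (stt : IsSTT E par)
                           (sc : SteinerClosedSTT E par) (x : Fin n) where
  open Walks E tree
  open SearchTrees E tree par stt
  open Cardinality
  open IsTree tree renaming (sym to E-sym)

  P : Pred n
  P = SearchPath par x

  BoundaryCondition : Fin n → Set
  BoundaryCondition p = Card (δ p) 2 × Σ (Fin n) λ q → par q ≡ just p × P q × Card (δ q) 1

  hullNbr? : ∀ {p} → P p → ∀ w → Dec (HullNbrs E P p w)
  hullNbr? {p} Pp w with E? p w
  ... | no ¬pw = no (¬pw ∘ proj₂)
  ... | yes pw with any? (λ z → (z ⊑? x) ×-dec avoiding? p w z)
  ...   | yes (z , Pz , r) = yes (hullNbr-from Pp pw r Pz , pw)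
  ...   | no ∄z            = no (∄z ∘ hullNbr⇒walk)

  δ-on-path : ∀ {p d} → P p → δ p d → P d
  δ-on-path Pp δd = ⊑-trans (proj₁ (δ⇒strictly-above δd)) Pp

  off-path-below : ∀ {p q m} → par q ≡ just p → P q → Below p m → ¬ q ⊑ m → ¬ P m
  off-path-below qp Pq (p⊑m , m≢p) ¬q⊑m Pm with ⊑-linear Pm Pq
  ... | inj₂ q⊑m        = ¬q⊑m q⊑m
  ... | inj₁ here       = ¬q⊑m here
  ... | inj₁ (up e m⊑w) with parent-unique e qp
  ...   | refl = m≢p (⊑-antisym m⊑w p⊑m)

  -- The two paths fork at a node m below p and outside T_q: m is off P but in ch(P), with three
  -- neighbours in ch(P).
  ¬corridors-fork : ∀ {p q d d′ u} → P p → par q ≡ just p → P q → d ≢ d′ → δ p d → δ p d′ → E p u →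
                    Walk (Corridor p q d) u d → Walk (Corridor p q d′) u d′ → ⊥
  ¬corridors-fork {p} {q} {d} {d′} {u} Pp qp Pq d≢d′ δd δd′ pu ρ ρ′ with walk→path ρ | walk→path ρ′
  ... | R₁ , c₁ , un₁ , l₁ , a₁ | R₂ , c₂ , un₂ , l₂ , a₂ =
    card-2-¬three (sc x m (hull₁ (there m∈₁)) m∉P)
      (pre , s₁ , s₂ , (hull₁ pre∈ , m-pre) , (hull₁ (there s₁∈) , m-s₁) , (hull₂ (there s₂∈) , m-s₂) ,
       pre≢s₁ , pre≢s₂ , s₁≢s₂)
    where
      avoid₁ = All.map (≢-sym ∘ corridor⇒≢ (proj₁ δd)) a₁
      avoid₂ = All.map (≢-sym ∘ corridor⇒≢ (proj₁ δd′)) a₂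
      hull₁ : ∀ {y} → y ∈ (p ∷ u ∷ R₁) → Hull E P y
      hull₁ = hull-path ((pu , c₁) , (avoid₁ ∷ un₁) , refl , l₁) Pp (δ-on-path Pp δd)
      hull₂ : ∀ {y} → y ∈ (p ∷ u ∷ R₂) → Hull E P y
      hull₂ = hull-path ((pu , c₂) , (avoid₂ ∷ un₂) , refl , l₂) Pp (δ-on-path Pp δd′)
      open Fork (fork p u R₁ R₂ pu (All¬⇒¬Any avoid₁) (All¬⇒¬Any avoid₂) c₁ c₂ un₁ un₂ l₁ l₂
                   (corridor-excludes (proj₁ δd) d≢d′ ∘ lookup a₂)
                   (corridor-excludes (proj₁ δd′) (≢-sym d≢d′) ∘ lookup a₁))
      m-below : Below p m
      m-below with proj₁ (lookup a₁ m∈₁)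
      ... | inj₁ below = below
      ... | inj₂ m≡d   =
        ⊥-elim (corridor-excludes (proj₁ δd) d≢d′ (subst (Corridor p q d′) m≡d (lookup a₂ m∈₂)))
      m∉P : ¬ P m
      m∉P = off-path-below qp Pq m-below (proj₂ (lookup a₁ m∈₁))

  corridor-target-unique : ∀ {p q d d′ u} → P p → par q ≡ just p → P q → δ p d → δ p d′ → E p u →
                           Walk (Corridor p q d) u d → Walk (Corridor p q d′) u d′ → d ≡ d′
  corridor-target-unique {d = d} {d′} Pp qp Pq δd δd′ pu ρ ρ′ with d ≟ d′
  ... | yes d≡d′ = d≡d′
  ... | no d≢d′  = ⊥-elim (¬corridors-fork Pp qp Pq d≢d′ δd δd′ pu ρ ρ′)

  UpBranch : Fin n → Fin n → Fin n → Set
  UpBranch w₀ p w = E p w × Σ (Fin n) λ z → Walk (_≢ p) w z × z ⊑ w₀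

  up-branch-in-hull : ∀ {w₀ p wᵢ wⱼ} → UpBranch w₀ p wᵢ → UpBranch w₀ p wⱼ → wᵢ ≢ wⱼ →
                      Hull E (SearchPath par w₀) p × HullNbrs E (SearchPath par w₀) p wᵢ
  up-branch-in-hull (eᵢ , _ , rᵢ , zᵢ⊑w₀) (eⱼ , _ , rⱼ , zⱼ⊑w₀) wᵢ≢wⱼ with through-branches eᵢ eⱼ wᵢ≢wⱼ rᵢ rⱼ
  ... | _ , π , p∈ , wᵢ∈ = hull-path π zᵢ⊑w₀ zⱼ⊑w₀ p∈ , hull-path π zᵢ⊑w₀ zⱼ⊑w₀ wᵢ∈ , eᵢ

  -- p lies in the hull of the search path of its parent w₀ but not on it, so it has only two
  -- neighbours there.
  ¬three-up-branches : ∀ {w₀ p w₁ w₂ w₃} → par p ≡ just w₀ →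
                       UpBranch w₀ p w₁ → UpBranch w₀ p w₂ → UpBranch w₀ p w₃ →
                       w₁ ≢ w₂ → w₁ ≢ w₃ → w₂ ≢ w₃ → ⊥
  ¬three-up-branches {w₀} {p} pw₀ b₁ b₂ b₃ w₁≢w₂ w₁≢w₃ w₂≢w₃ =
    card-2-¬three (sc w₀ p (proj₁ h₁) (¬⊑-parent pw₀))
      (_ , _ , _ , proj₂ h₁ , proj₂ (up-branch-in-hull b₂ b₁ (≢-sym w₁≢w₂)) ,
       proj₂ (up-branch-in-hull b₃ b₁ (≢-sym w₁≢w₃)) , w₁≢w₂ , w₁≢w₃ , w₂≢w₃)
    where
      h₁ = up-branch-in-hull b₁ b₂ w₁≢w₂

  ¬⊑-above-parent : ∀ {p w₀ z} → par p ≡ just w₀ → z ⊑ w₀ → ¬ p ⊑ z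
  ¬⊑-above-parent pw₀ z⊑w₀ p⊑z = ¬⊑-parent pw₀ (⊑-trans p⊑z z⊑w₀)

  δ-route⇒up-branch : ∀ {w₀ p q d u} → par p ≡ just w₀ → δ p d → E p u →
                      Walk (Corridor p q d) u d → UpBranch w₀ p u
  δ-route⇒up-branch pw₀ δd pu ρ = pu , _ , corridor⇒avoiding (proj₁ δd) ρ , δ⇒⊑-parent pw₀ δd

  -- P is a chain, so both ends hang below the same child q of p, and T_q is connected and avoids p.
  ¬two-down-branches : ∀ {p wᵢ wⱼ zᵢ zⱼ} → E p wᵢ → E p wⱼ → wᵢ ≢ wⱼ →
                       Walk (_≢ p) wᵢ zᵢ → Walk (_≢ p) wⱼ zⱼ → P zᵢ → P zⱼ → Below p zᵢ → Below p zⱼ → ⊥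
  ¬two-down-branches eᵢ eⱼ wᵢ≢wⱼ rᵢ rⱼ Pᵢ Pⱼ (p⊑zᵢ , zᵢ≢p) (p⊑zⱼ , zⱼ≢p)
    with child-towards p⊑zᵢ zᵢ≢p | child-towards p⊑zⱼ zⱼ≢p
  ... | q , qp , q⊑zᵢ | q′ , q′p , q′⊑zⱼ with child-unique qp q′p (⊑-trans q⊑zᵢ Pᵢ) (⊑-trans q′⊑zⱼ Pⱼ)
  ... | refl = wᵢ≢wⱼ (branch-unique eᵢ eⱼ
                 (rᵢ ++ʷ walk-map (subtree-avoids-parent qp) (walk-in-subtree q⊑zᵢ q′⊑zⱼ)) rⱼ)

  -- Any other node of δ(T_q) would be reached from w through T_q, making w a third up-branch.
  δ-child-only-parent : ∀ {w₀ p q w w₁ w₂ z} → par p ≡ just w₀ →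
                        UpBranch w₀ p w₁ → UpBranch w₀ p w₂ → w₁ ≢ w₂ →
                        E p w → w ≢ w₁ → w ≢ w₂ → Walk (_≢ p) w z → par q ≡ just p → q ⊑ z →
                        ∀ {d} → δ q d → d ≡ p
  δ-child-only-parent {p = p} pw₀ b₁ b₂ w₁≢w₂ pw w≢w₁ w≢w₂ r qp q⊑z {d} δd@(_ , _ , q⊑t , dt) with d ≟ p
  ... | yes d≡p = d≡p
  ... | no d≢p  = ⊥-elim (¬three-up-branches pw₀ (pw , d , r′ , d⊑w₀) b₁ b₂ w≢w₁ w≢w₂ w₁≢w₂)
    where
      r′ = walk-snoc (r ++ʷ walk-map (subtree-avoids-parent qp) (walk-in-subtree q⊑z q⊑t)) (E-sym dt) d≢p
      d⊑w₀ = ⊑-parent (δ⇒⊑-parent qp δd) d≢p pw₀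

  two-up-branches⇒δ-card-2 : ∀ {w₀ p q w₁ w₂} → P p → par q ≡ just p → P q → (∀ {d} → δ q d → d ≡ p) →
          par p ≡ just w₀ → UpBranch w₀ p w₁ → UpBranch w₀ p w₂ → w₁ ≢ w₂ → Card (δ p) 2
  two-up-branches⇒δ-card-2 {p = p} {w₁ = w₁} {w₂} Pp qp Pq only-p pw₀
                           b₁@(pw₁ , _ , r₁ , z₁⊑w₀) b₂@(pw₂ , _ , r₂ , z₂⊑w₀) w₁≢w₂
    with corridor-from-branch qp only-p pw₁ r₁ (¬⊑-above-parent pw₀ z₁⊑w₀)
       | corridor-from-branch qp only-p pw₂ r₂ (¬⊑-above-parent pw₀ z₂⊑w₀)
  ... | d₁ , δd₁ , ρ₁ | d₂ , δd₂ , ρ₂ = card-2-intro d₁≢d₂ δd₁ δd₂ only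
    where
      d₁≢d₂ : d₁ ≢ d₂
      d₁≢d₂ refl =
        w₁≢w₂ (branch-unique pw₁ pw₂ (corridor⇒avoiding (proj₁ δd₁) ρ₁) (corridor⇒avoiding (proj₁ δd₂) ρ₂))
      only : ∀ d → δ p d → d ≡ d₁ ⊎ d ≡ d₂
      only d δd with corridor-to-δ qp only-p δd
      ... | u , pu , ρ with u ≟ w₁ | u ≟ w₂
      ... | yes refl | _        = inj₁ (corridor-target-unique Pp qp Pq δd δd₁ pu ρ ρ₁)
      ... | no _     | yes refl = inj₂ (corridor-target-unique Pp qp Pq δd δd₂ pu ρ ρ₂)
      ... | no u≢w₁  | no u≢w₂  =
        ⊥-elim (¬three-up-branches pw₀ (δ-route⇒up-branch pw₀ δd pu ρ) b₁ b₂ u≢w₁ u≢w₂ w₁≢w₂)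

  one-down-two-up⇒boundary-condition : ∀ {w₀ p w₁ w₂ w z} → P p → par p ≡ just w₀ →
                    UpBranch w₀ p w₁ → UpBranch w₀ p w₂ → w₁ ≢ w₂ →
                    E p w → w ≢ w₁ → w ≢ w₂ → Walk (_≢ p) w z → P z → Below p z → BoundaryCondition p
  one-down-two-up⇒boundary-condition Pp pw₀ b₁ b₂ w₁≢w₂ pw w≢w₁ w≢w₂ r Pz (p⊑z , z≢p)
    with child-towards p⊑z z≢p
  ... | q , qp , q⊑z =
    two-up-branches⇒δ-card-2 Pp qp Pq only-p pw₀ b₁ b₂ w₁≢w₂ ,
    q , qp , Pq , card-1-intro (parent∈δ qp) (λ _ → only-p)
    where
      Pq = ⊑-trans q⊑z Pz
      only-p = δ-child-only-parent pw₀ b₁ b₂ w₁≢w₂ pw w≢w₁ w≢w₂ r qp q⊑z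

  Up : Fin n → Fin n → Set
  Up p z = Σ (Fin n) λ w₀ → par p ≡ just w₀ × z ⊑ w₀

  above-or-below : ∀ {p w z} → P p → Walk (_≢ p) w z → P z → Up p z ⊎ Below p z
  above-or-below Pp r Pz with ⊑-linear Pz Pp
  ... | inj₂ p⊑z        = inj₂ (p⊑z , walk-last r)
  ... | inj₁ here       = ⊥-elim (walk-last r refl)
  ... | inj₁ (up e z⊑w) = inj₁ (_ , e , z⊑w)

  up-branch : ∀ {w₀ p w z} → par p ≡ just w₀ → E p w → Walk (_≢ p) w z → Up p z → UpBranch w₀ p w
  up-branch pw₀ pw r (_ , pw₀′ , z⊑w₀′) with parent-unique pw₀′ pw₀
  ... | refl = pw , _ , r , z⊑w₀′

  branching⇒boundary-condition : ∀ {p} → P p → Branching E P p → BoundaryCondition p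
  branching⇒boundary-condition Pp (_ , _ , 2<k , card) with card->2⇒three card 2<k
  ... | w₁ , w₂ , w₃ , h₁@(_ , pw₁) , h₂@(_ , pw₂) , h₃@(_ , pw₃) , w₁≢w₂ , w₁≢w₃ , w₂≢w₃
    with hullNbr⇒walk h₁ | hullNbr⇒walk h₂ | hullNbr⇒walk h₃
  ... | z₁ , P₁ , r₁ | z₂ , P₂ , r₂ | z₃ , P₃ , r₃
    with above-or-below Pp r₁ P₁ | above-or-below Pp r₂ P₂ | above-or-below Pp r₃ P₃
  ... | inj₁ u₁@(_ , pw₀ , _) | inj₁ u₂ | inj₁ u₃ =
    ⊥-elim (¬three-up-branches pw₀ (up-branch pw₀ pw₁ r₁ u₁) (up-branch pw₀ pw₂ r₂ u₂)
              (up-branch pw₀ pw₃ r₃ u₃) w₁≢w₂ w₁≢w₃ w₂≢w₃)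
  ... | inj₂ b₁ | inj₂ b₂ | _       = ⊥-elim (¬two-down-branches pw₁ pw₂ w₁≢w₂ r₁ r₂ P₁ P₂ b₁ b₂)
  ... | inj₂ b₁ | _       | inj₂ b₃ = ⊥-elim (¬two-down-branches pw₁ pw₃ w₁≢w₃ r₁ r₃ P₁ P₃ b₁ b₃)
  ... | _       | inj₂ b₂ | inj₂ b₃ = ⊥-elim (¬two-down-branches pw₂ pw₃ w₂≢w₃ r₂ r₃ P₂ P₃ b₂ b₃)
  ... | inj₂ b₁ | inj₁ u₂@(_ , pw₀ , _) | inj₁ u₃ =
    one-down-two-up⇒boundary-condition Pp pw₀ (up-branch pw₀ pw₂ r₂ u₂) (up-branch pw₀ pw₃ r₃ u₃) w₂≢w₃
                    pw₁ w₁≢w₂ w₁≢w₃ r₁ P₁ b₁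
  ... | inj₁ u₁@(_ , pw₀ , _) | inj₂ b₂ | inj₁ u₃ =
    one-down-two-up⇒boundary-condition Pp pw₀ (up-branch pw₀ pw₁ r₁ u₁) (up-branch pw₀ pw₃ r₃ u₃) w₁≢w₃
                    pw₂ (≢-sym w₁≢w₂) w₂≢w₃ r₂ P₂ b₂
  ... | inj₁ u₁@(_ , pw₀ , _) | inj₁ u₂ | inj₂ b₃ =
    one-down-two-up⇒boundary-condition Pp pw₀ (up-branch pw₀ pw₁ r₁ u₁) (up-branch pw₀ pw₂ r₂ u₂) w₁≢w₂
                    pw₃ (≢-sym w₁≢w₃) (≢-sym w₂≢w₃) r₃ P₃ b₃

  δ-card-1⇒only-parent : ∀ {p q} → par q ≡ just p → Card (δ q) 1 → ∀ {d} → δ q d → d ≡ p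
  δ-card-1⇒only-parent qp δq₁ δd = card-1-elim δq₁ δd (parent∈δ qp)

  boundary-condition⇒branching : ∀ {p} → P p → BoundaryCondition p → Branching E P p
  boundary-condition⇒branching {p} Pp (δp₂ , q , qp , Pq , δq₁)
    with card-2-elim δp₂ | parent∈δ qp
  ... | a , b , a≢b , δa , δb , _ | _ , s , q⊑s , ps
    with corridor-to-δ qp (δ-card-1⇒only-parent qp δq₁) δa | corridor-to-δ qp (δ-card-1⇒only-parent qp δq₁) δb
  ... | uₐ , puₐ , ρₐ | u_b , pu_b , ρ_b =
    hull-self Pp , proj₁ count ,
    three⇒card->2 (proj₂ count)
      (s , uₐ , u_b , nbr-s , nbr δa puₐ ρₐ , nbr δb pu_b ρ_b , s≢u ρₐ , s≢u ρ_b , uₐ≢u_b) ,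
    proj₂ count
    where
      count = card-exists (hullNbr? Pp)
      nbr-s : HullNbrs E P p s
      nbr-s = hullNbr-from Pp ps (walk-map (subtree-avoids-parent qp) (walk-in-subtree q⊑s here)) Pq , ps
      nbr : ∀ {d u} → δ p d → E p u → Walk (Corridor p q d) u d → HullNbrs E P p u
      nbr δd pu ρ = hullNbr-from Pp pu (corridor⇒avoiding (proj₁ δd) ρ) (δ-on-path Pp δd) , pu
      s≢u : ∀ {d u} → Walk (Corridor p q d) u d → s ≢ u
      s≢u ρ refl = proj₂ (walk-first ρ) q⊑s
      uₐ≢u_b : uₐ ≢ u_b
      uₐ≢u_b refl = a≢b (corridor-target-unique Pp qp Pq δa δb puₐ ρₐ ρ_b)

lemma13 : {n : ℕ} (E : Fin n → Fin n → Set) → IsTree E →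
          (par : Fin n → Maybe (Fin n)) → IsSTT E par → SteinerClosedSTT E par →
          (x p : Fin n) → SearchPath par x p →
          Branching E (SearchPath par x) p
            ⇔ (Card (Boundary E par p) 2 ×
               Σ (Fin n) (λ q → par q ≡ just p × SearchPath par x q × Card (Boundary E par q) 1))
lemma13 E tree par stt sc x p Pp =
  mk⇔ (branching⇒boundary-condition Pp) (boundary-condition⇒branching Pp)
  where open SearchPathBranching E tree par stt sc x
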